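{- Let $(\Gamma,\tau)$ be a $z$-oriented triangulation of a connected closed surface. If $(\Gamma,\tau)$ has a face of type I, then the Markov chain $\mathcal{X}_\tau$ is ergodic.
   Context: A triangulation $\Gamma$ of a connected closed $2$-dimensional surface (not necessarily orientable) is a closed $2$-cell embedding of a connected finite simple graph in which every face is a triangle. Two edges are adjacent if distinct and lying in a common face. A zigzag is a cyclic sequence of edges $e_1,\dots,e_n$ (indices mod $n$, $n$ minimal) with $e_i,e_{i+1}$ adjacent, the faces containing $\{e_i,e_{i+1}\}$ and $\{e_{i+1},e_{i+2}\}$ adjacent (distinct, sharing an edge), and $e_i,e_{i+2}$ disjoint; as a cyclic vertex sequence $v_1,\dots,v_n$ with $e_i=v_iv_{i+1}$ it traverses $e_i$ from $v_i$ to $v_{i+1}$. A $z$-orientation $\tau$ contains exactly one of $Z,Z^{ -1}$ for each zigzag $Z$. Each edge is traversed exactly twice in total by the zigzags of $\tau$; it is of type I if in opposite directions, of type II (directed accordingly) if in the same direction. Every face either has two type I edges and one type II edge (face of type I) or three type II edges forming a directed cycle (face of type II). The Markov chain $\mathcal{X}_\tau$ has state space the vertex set $V$; with $d(v)$ = (number of type I edges at $v$) + 2·(number of type II edges directed out of $v$), the transition probability from $v_i$ to $v_j$ is $1/d(v_i)$ if $v_iv_j$ is of type I, $2/d(v_i)$ if it is of type II directed from $v_i$ to $v_j$, and $0$ otherwise. Ergodic means irreducible and aperiodic. -}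

module Defs where

open import Data.Nat as ℕ using (ℕ; zero; suc; _∸_; _≤_; _<_) renaming (_+_ to _+ℕ_; _*_ to _*ℕ_)
open import Data.Nat.Divisibility using (_∣_)
open import Data.Integer using (+_)
open import Data.Rational as Q using (ℚ; 0ℚ; 1ℚ; _+_; _*_; _/_) renaming (_<_ to _<ℚ_)
open import Data.Fin using (Fin; _≟_)
open import Data.Bool using (Bool; true; false; _∧_; not; if_then_else_)
open import Data.List using (List; upTo)
open import Data.Bool.ListAction using (any)
open import Data.List.Relation.Unary.Any using (Any)
open import Data.Product using (_×_; ∃; Σ)
open import Data.Sum using (_⊎_)
open import Relation.Nullary using (¬_)
open import Relation.Nullary.Decidable using (⌊_⌋)
open import Relation.Binary.PropositionalEquality using (_≡_; _≢_)
open import Relation.Binary.Construct.Closure.ReflexiveTransitive using (Star)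

-- Vertices: Fin N.  face a b c ≡ true  iff  {a,b,c} is a face.
-- (The graph is simple, so an edge is a pair of vertices; a face of a
-- triangulation is determined by its three vertices.)

record Triangulation : Set where
  field
    N    : ℕ
    face : Fin N → Fin N → Fin N → Bool
    face-sym₁ : ∀ a b c → face a b c ≡ face b a c
    face-sym₂ : ∀ a b c → face a b c ≡ face a c b
    face-distinct : ∀ a b c → face a b c ≡ true → a ≢ b

  -- the edges of the graph are the sides of the faces (2-cell embedding)
  Edge : Fin N → Fin N → Set
  Edge u v = ∃ λ w → face u v w ≡ true

  field
    -- closed surface: every edge lies in exactly two faces ...
    edge-two-faces : ∀ u v → Edge u v →
      Σ (Fin N) λ w₁ → Σ (Fin N) λ w₂ →
        w₁ ≢ w₂ × face u v w₁ ≡ true × face u v w₂ ≡ true ×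
        (∀ w → face u v w ≡ true → w ≡ w₁ ⊎ w ≡ w₂)
    -- ... and the link of every vertex is connected (hence a single cycle)
    link-connected : ∀ v a b → Edge v a → Edge v b →
      Star (λ x y → face v x y ≡ true) a b
    connected : ∀ u v → Star Edge u v

module _ (T : Triangulation) where
  open Triangulation T

  -- A zigzag as a cyclic vertex sequence v_0 … v_{len-1}, written as a
  -- len-periodic function ℕ → vertices; edge e_i = v_i v_{i+1}.
  record Zigzag : Set where
    field
      len      : ℕ
      len-pos  : 0 < len
      seq      : ℕ → Fin N
      periodic : ∀ i → seq (i +ℕ len) ≡ seq i
      minimal  : ∀ p → 0 < p → p < len → ¬ (∀ i → seq (i +ℕ p) ≡ seq i)
      -- e_i, e_{i+1} distinct and lying in a common face {v_i,v_{i+1},v_{i+2}}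
      zz-face  : ∀ i → face (seq i) (seq (1 +ℕ i)) (seq (2 +ℕ i)) ≡ true
      -- the faces {v_i,v_{i+1},v_{i+2}} and {v_{i+1},v_{i+2},v_{i+3}}
      -- (sharing edge e_{i+1}) are distinct
      zz-distinct-faces : ∀ i → seq (3 +ℕ i) ≢ seq i
      zz-disjoint : ∀ i →
        seq i ≢ seq (2 +ℕ i) × seq i ≢ seq (3 +ℕ i) ×
        seq (1 +ℕ i) ≢ seq (2 +ℕ i) × seq (1 +ℕ i) ≢ seq (3 +ℕ i)
  open Zigzag public

  Raw : Set
  Raw = Σ ℕ λ _ → ℕ → Fin N

  raw : Zigzag → Raw
  raw Z = len Z Data.Product., seq Z

  _≈_ : Raw → Raw → Set
  (n Data.Product., w) ≈ (m Data.Product., w') =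
    n ≡ m × ∃ λ s → ∀ i → w (s +ℕ i) ≡ w' i

  -- the reversed sequence Z⁻¹ : i ↦ v_{-i}
  rev : Raw → Raw
  rev (n Data.Product., w) = n Data.Product., λ i → w (n *ℕ suc i ∸ i)

  _∈τ_ : Raw → List Zigzag → Set
  X ∈τ τ = Any (λ Z → raw Z ≈ X) τ

  IsZOrientation : List Zigzag → Set
  IsZOrientation τ = ∀ (Z : Zigzag) →
    (raw Z ∈τ τ ⊎ rev (raw Z) ∈τ τ) ×
    (raw Z ∈τ τ → rev (raw Z) ∈τ τ → raw Z ≈ rev (raw Z))

  trav : List Zigzag → Fin N → Fin N → Bool
  trav τ u v = any (λ Z → any (λ i → ⌊ seq Z i ≟ u ⌋ ∧ ⌊ seq Z (suc i) ≟ v ⌋)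
                                (upTo (len Z))) τ

  -- type I: traversed in opposite directions;
  -- type II directed u → v: traversed (twice) only from u to v
  TypeI : List Zigzag → Fin N → Fin N → Set
  TypeI τ u v = trav τ u v ≡ true × trav τ v u ≡ true

  TypeII : List Zigzag → Fin N → Fin N → Set
  TypeII τ u v = trav τ u v ≡ true × trav τ v u ≡ false

  HasFaceOfTypeI : List Zigzag → Set
  HasFaceOfTypeI τ = ∃ λ a → ∃ λ b → ∃ λ c →
    face a b c ≡ true × TypeI τ a b × TypeI τ b c ×
    (TypeII τ c a ⊎ TypeII τ a c)

  weight : List Zigzag → Fin N → Fin N → ℕ
  weight τ u v = if trav τ u v then (if trav τ v u then 1 else 2) else 0

  sumFinℕ : ∀ {n} → (Fin n → ℕ) → ℕ
  sumFinℕ {zero}  f = 0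
  sumFinℕ {suc n} f = f Data.Fin.zero +ℕ sumFinℕ (λ i → f (Data.Fin.suc i))

  deg : List Zigzag → Fin N → ℕ
  deg τ u = sumFinℕ (weight τ u)

  transition : List Zigzag → Fin N → Fin N → ℚ
  transition τ u v with deg τ u
  ... | zero  = 0ℚ
  ... | suc k = + weight τ u v / suc k

sumFinℚ : ∀ {n} → (Fin n → ℚ) → ℚ
sumFinℚ {zero}  f = 0ℚ
sumFinℚ {suc n} f = f Data.Fin.zero + sumFinℚ (λ i → f (Data.Fin.suc i))

Matrix : ℕ → Set
Matrix n = Fin n → Fin n → ℚ

idM : ∀ {n} → Matrix n
idM u v = if ⌊ u ≟ v ⌋ then 1ℚ else 0ℚ

_⊗_ : ∀ {n} → Matrix n → Matrix n → Matrix n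
(A ⊗ B) u v = sumFinℚ (λ x → A u x * B x v)

_^_ : ∀ {n} → Matrix n → ℕ → Matrix n
P ^ zero  = idM
P ^ suc k = P ⊗ (P ^ k)

Irreducible : ∀ {n} → Matrix n → Set
Irreducible P = ∀ u v → ∃ λ k → 0ℚ <ℚ (P ^ k) u v

Aperiodic : ∀ {n} → Matrix n → Set
Aperiodic P = ∀ v (d : ℕ) →
  (∀ k → 1 ≤ k → 0ℚ <ℚ (P ^ k) v v → d ∣ k) → d ≡ 1

Ergodic : ∀ {n} → Matrix n → Set
Ergodic P = Irreducible P × Aperiodic P

-- Every edge uv lies on a zigzag, and the z-orientation contains that
-- zigzag or its reverse, so some zigzag of τ traverses uv in one direction;
-- following that zigzag around leads back, so the chain moves along every
-- edge in both directions and connectedness of Γ gives irreducibility.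
-- In a face abc of type I, the type I edge ab gives a closed walk a → b → a
-- of length 2, and the face itself, whose type II edge is compatible with
-- the directions of ab and bc, gives a closed walk of length 3 through a;
-- hence every period divides two consecutive integers.
module Submission where

open import Defs
open import Data.Bool as Bool using (true; false)
open import Data.Bool.Properties using (T-≡)
open import Data.Fin using (Fin; _≟_; toℕ; combine)
open import Data.Fin.Properties using (pigeonhole; combine-injective)
open import Data.List using (List; upTo)
open import Data.List.Membership.Propositional using (_∈_; find; lose)
open import Data.List.Membership.Propositional.Properties using (∈-upTo⁺)
open import Data.List.Relation.Unary.Any.Properties using (any⁺; any⁻)
open import Data.Nat using (ℕ; zero; suc; pred; _+_; _*_; _∸_; _≤_; _<_; z≤n; s≤s; NonZero; >-nonZero)
open import Data.Nat.DivMod using (_%_; _/_; m≡m%n+[m/n]*n; m%n<n)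
open import Data.Nat.Divisibility using (_∣_; _∣0; ∣m+n∣m⇒∣n; ∣1⇒≡1)
open import Data.Nat.GeneralisedArithmetic using (fold)
open import Data.Nat.Induction using (<-rec)
open import Data.Nat.Properties hiding (_≟_)
open import Data.Product using (_×_; ∃; Σ; _,_; proj₁; proj₂)
open import Data.Rational as ℚ using (0ℚ)
import Data.Rational.Properties as ℚ
open import Data.Sum using (_⊎_; inj₁; inj₂; [_,_])
open import Function using (_∘_; id; _⇔_; mk⇔; Equivalence)
open import Relation.Binary.Construct.Closure.ReflexiveTransitive using (Star; ε; _◅_)
open import Relation.Binary.Definitions using (DecidableEquality)
open import Relation.Binary.PropositionalEquality using (_≡_; _≢_; refl; sym; trans; cong; subst; subst₂; module ≡-Reasoning)
open import Relation.Nullary using (¬_; yes; no; contradiction)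
open import Relation.Nullary.Decidable using (⌊_⌋; map′; _×-dec_)
open import Relation.Unary using (Decidable)

open Equivalence using (to; from)

module _ {A : Set} {s : ℕ → A} {L : ℕ} (s-periodic : ∀ i → s (i + L) ≡ s i) where

  periodic-+* : ∀ i q → s (i + q * L) ≡ s i
  periodic-+* i zero    = cong s (+-identityʳ i)
  periodic-+* i (suc q) = begin
    s (i + (L + q * L)) ≡⟨ cong s (trans (cong (i +_) (+-comm L (q * L))) (sym (+-assoc i (q * L) L))) ⟩
    s (i + q * L + L)   ≡⟨ s-periodic (i + q * L) ⟩
    s (i + q * L)       ≡⟨ periodic-+* i q ⟩
    s i                 ∎
    where open ≡-Reasoning

  module _ .{{_ : NonZero L}} where

    periodic-% : ∀ i → s (i % L) ≡ s i
    periodic-% i = begin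
      s (i % L)             ≡⟨ periodic-+* (i % L) (i / L) ⟨
      s (i % L + i / L * L) ≡⟨ cong s (m≡m%n+[m/n]*n i L) ⟨
      s i                   ∎
      where open ≡-Reasoning

    periodic-from-prefix : ∀ p → (∀ {i} → i < L → s (i + p) ≡ s i) → ∀ i → s (i + p) ≡ s i
    periodic-from-prefix p prefix i = begin
      s (i + p)                 ≡⟨ cong (λ j → s (j + p)) (m≡m%n+[m/n]*n i L) ⟩
      s (r + i / L * L + p)     ≡⟨ cong s (trans (+-assoc r _ p) (trans (cong (r +_) (+-comm _ p)) (sym (+-assoc r p _)))) ⟩
      s (r + p + i / L * L)     ≡⟨ periodic-+* (r + p) (i / L) ⟩
      s (r + p)                 ≡⟨ prefix (m%n<n i L) ⟩
      s r                       ≡⟨ periodic-% i ⟩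
      s i                       ∎
      where
      open ≡-Reasoning
      r = i % L

Least : (ℕ → Set) → ℕ → Set
Least P m = P m × (∀ {k} → k < m → ¬ P k)

least-witness : {P : ℕ → Set} → Decidable P → ∀ {n} → P n → ∃ (Least P)
least-witness {P} P? {n} = <-rec (λ n → P n → ∃ (Least P)) search n
  where
  search : ∀ n → (∀ {m} → m < n → P m → ∃ (Least P)) → P n → ∃ (Least P)
  search n smaller pn with anyUpTo? P? n
  ... | yes (m , m<n , pm) = smaller m<n pm
  ... | no none            = n , pn , λ k<n pk → none (_ , k<n , pk)

IsPeriod : {A : Set} → (ℕ → A) → ℕ → Set
IsPeriod s p = 0 < p × (∀ i → s (i + p) ≡ s i)

least-period : {A : Set} → DecidableEquality A → (s : ℕ → A) → ∀ {L} → IsPeriod s L →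
               ∃ (Least (IsPeriod s))
least-period _≟ᴬ_ s {L} (0<L , s-periodic) = least-witness isPeriod? (0<L , s-periodic)
  where
  instance
    L-nonZero : NonZero L
    L-nonZero = >-nonZero 0<L

  isPeriod? : Decidable (IsPeriod s)
  isPeriod? p = (0 <? p) ×-dec map′ (periodic-from-prefix s-periodic p) (λ per {i} _ → per i)
                                    (allUpTo? (λ i → s (i + p) ≟ᴬ s i) L)

-- f permutes the finite invariant set S, so its orbits in S are cyclic.
module InjectiveOrbits {A : Set} {n : ℕ} (encode : A → Fin n) (encode-injective : ∀ {a b} → encode a ≡ encode b → a ≡ b)
         {S : A → Set} {f : A → A} (f-closed : ∀ {a} → S a → S (f a))
         (f-injective : ∀ {a b} → S a → S b → f a ≡ f b → a ≡ b) where

  fold-closed : ∀ {a} → S a → ∀ i → S (fold a f i)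
  fold-closed sa zero    = sa
  fold-closed sa (suc i) = f-closed (fold-closed sa i)

  orbit-periodic : ∀ {a} → S a → ∃ (IsPeriod (fold a f))
  orbit-periodic {a} sa with pigeonhole (n<1+n n) (encode ∘ fold a f ∘ toℕ)
  ... | i , j , i<j , same = d , m<n⇒0<n∸m i<j , returns
    where
    d = toℕ j ∸ toℕ i

    cancel : ∀ m → fold a f m ≡ fold a f (m + d) → a ≡ fold a f d
    cancel zero    e = e
    cancel (suc m) e = cancel m (f-injective (fold-closed sa m) (fold-closed sa (m + d)) e)

    returns : ∀ m → fold a f (m + d) ≡ fold a f m
    returns zero    = sym (cancel (toℕ i) (trans (encode-injective same)
                                                 (cong (fold a f) (sym (m+[n∸m]≡n (<⇒≤ i<j))))))
    returns (suc m) = cong f (returns m)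

infixr 5 _∷_ _++_

data Walk {A : Set} (R : A → A → Set) : ℕ → A → A → Set where
  []  : ∀ {u} → Walk R 0 u u
  _∷_ : ∀ {k u x v} → R u x → Walk R k x v → Walk R (suc k) u v

_++_ : ∀ {A : Set} {R : A → A → Set} {k l u x v} → Walk R k u x → Walk R l x v → Walk R (k + l) u v
[]       ++ w₂ = w₂
(r ∷ w₁) ++ w₂ = r ∷ (w₁ ++ w₂)

0≤sumFinℚ : ∀ {n} (f : Fin n → ℚ.ℚ) → (∀ i → 0ℚ ℚ.≤ f i) → 0ℚ ℚ.≤ sumFinℚ f
0≤sumFinℚ {zero}  f f≥0 = ℚ.≤-refl
0≤sumFinℚ {suc n} f f≥0 = ℚ.+-mono-≤ (f≥0 _) (0≤sumFinℚ (f ∘ Fin.suc) (f≥0 ∘ Fin.suc))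

0<sumFinℚ : ∀ {n} (f : Fin n → ℚ.ℚ) → (∀ i → 0ℚ ℚ.≤ f i) → ∀ j → 0ℚ ℚ.< f j → 0ℚ ℚ.< sumFinℚ f
0<sumFinℚ f f≥0 Fin.zero    fj>0 = ℚ.+-mono-<-≤ fj>0 (0≤sumFinℚ (f ∘ Fin.suc) (f≥0 ∘ Fin.suc))
0<sumFinℚ f f≥0 (Fin.suc j) fj>0 = ℚ.+-mono-≤-< (f≥0 _) (0<sumFinℚ (f ∘ Fin.suc) (f≥0 ∘ Fin.suc) j fj>0)

0≤* : ∀ {p q} → 0ℚ ℚ.≤ p → 0ℚ ℚ.≤ q → 0ℚ ℚ.≤ p ℚ.* q
0≤* {p} {q} p≥0 q≥0 = ℚ.nonNegative⁻¹ _ {{ℚ.nonNeg*nonNeg⇒nonNeg p {{ℚ.nonNegative p≥0}} q {{ℚ.nonNegative q≥0}}}}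

0<* : ∀ {p q} → 0ℚ ℚ.< p → 0ℚ ℚ.< q → 0ℚ ℚ.< p ℚ.* q
0<* {p} {q} p>0 q>0 = ℚ.positive⁻¹ _ {{ℚ.pos*pos⇒pos p {{ℚ.positive p>0}} q {{ℚ.positive q>0}}}}

idM≥0 : ∀ {n} (u v : Fin n) → 0ℚ ℚ.≤ idM u v
idM≥0 u v with u ≟ v
... | yes _ = ℚ.nonNegative⁻¹ ℚ.1ℚ
... | no  _ = ℚ.≤-refl

idM-diagonal>0 : ∀ {n} (u : Fin n) → 0ℚ ℚ.< idM u u
idM-diagonal>0 u with u ≟ u
... | yes _   = ℚ.positive⁻¹ ℚ.1ℚ
... | no  u≢u = contradiction refl u≢u

module _ {n} (P : Matrix n) (P≥0 : ∀ u v → 0ℚ ℚ.≤ P u v)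
         {R : Fin n → Fin n → Set} (R⇒P>0 : ∀ {u v} → R u v → 0ℚ ℚ.< P u v) where

  ^≥0 : ∀ k u v → 0ℚ ℚ.≤ (P ^ k) u v
  ^≥0 zero    = idM≥0
  ^≥0 (suc k) u v = 0≤sumFinℚ _ (λ x → 0≤* (P≥0 u x) (^≥0 k x v))

  walk⇒^>0 : ∀ {k u v} → Walk R k u v → 0ℚ ℚ.< (P ^ k) u v
  walk⇒^>0 {u = u} []                    = idM-diagonal>0 u
  walk⇒^>0 {suc k} {u} {v} (_∷_ {x = x} r w) =
    0<sumFinℚ _ (λ y → 0≤* (P≥0 u y) (^≥0 k y v)) x (0<* (R⇒P>0 r) (walk⇒^>0 w))

  module _ (strongly-connected : ∀ u v → ∃ λ k → Walk R k u v) where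

    irreducible : Irreducible P
    irreducible u v with strongly-connected u v
    ... | k , w = k , walk⇒^>0 w

    aperiodic : ∀ {a m} → Walk R m a a → Walk R (suc m) a a → Aperiodic P
    aperiodic {a} {m} loop loop′ v d d∣returns
      with strongly-connected v a | strongly-connected a v
    ... | p , v⇝a | q , a⇝v = ∣1⇒≡1 (∣m+n∣m⇒∣n (subst (d ∣_) lengths (d∣closed (v⇝a ++ loop′ ++ a⇝v)))
                                               (d∣closed (v⇝a ++ loop ++ a⇝v)))
      where
      d∣closed : ∀ {k} → Walk R k v v → d ∣ k
      d∣closed {zero}  _ = d ∣0
      d∣closed {suc k} w = d∣returns (suc k) (s≤s z≤n) (walk⇒^>0 w)

      lengths : p + (suc m + q) ≡ p + (m + q) + 1
      lengths = trans (+-suc p (m + q)) (+-comm 1 (p + (m + q)))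

module _ (T : Triangulation) where
  open Triangulation T

  face-rotate : ∀ {x y z} → face x y z ≡ true → face y z x ≡ true
  face-rotate {x} {y} {z} xyz = trans (sym (trans (face-sym₁ x y z) (face-sym₂ y x z))) xyz

  IsOtherApex : Fin N → Fin N → Fin N → Fin N → Set
  IsOtherApex x y z w = face y z w ≡ true × w ≢ x × (∀ w′ → face y z w′ ≡ true → w′ ≡ x ⊎ w′ ≡ w)

  other-apex-exists : ∀ {x y z} → face y z x ≡ true → ∃ (IsOtherApex x y z)
  other-apex-exists {x} {y} {z} yzx with edge-two-faces y z (x , yzx)
  ... | w₁ , w₂ , w₁≢w₂ , yzw₁ , yzw₂ , only with x ≟ w₁
  ...   | yes refl = w₂ , yzw₂ , w₁≢w₂ ∘ sym , only
  ...   | no  x≢w₁ = w₁ , yzw₁ , x≢w₁ ∘ sym ,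
                     λ w′ yzw′ → [ inj₂ , (λ w′≡w₂ → inj₁ (trans w′≡w₂ (sym x≡w₂))) ] (only w′ yzw′)
    where
    x≡w₂ : x ≡ w₂
    x≡w₂ = [ (λ x≡w₁ → contradiction x≡w₁ x≢w₁) , id ] (only x yzx)

  -- Off faces the value is junk (x itself); it is only used on faces.
  other-apex : Fin N → Fin N → Fin N → Fin N
  other-apex x y z with face y z x Bool.≟ true
  ... | yes yzx = proj₁ (other-apex-exists yzx)
  ... | no  _   = x

  other-apex-spec : ∀ {x y z} → face y z x ≡ true → IsOtherApex x y z (other-apex x y z)
  other-apex-spec {x} {y} {z} yzx with face y z x Bool.≟ true
  ... | yes yzx′ = proj₂ (other-apex-exists yzx′)
  ... | no  ¬yzx = contradiction yzx ¬yzx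

  Flag : Set
  Flag = Fin N × Fin N × Fin N

  IsFace : Flag → Set
  IsFace (x , y , z) = face x y z ≡ true

  -- Consecutive vertices x y z of a zigzag are followed by the apex of the
  -- other face on yz.
  zigzag-step : Flag → Flag
  zigzag-step (x , y , z) = y , z , other-apex x y z

  zigzag-step-closed : ∀ {t} → IsFace t → IsFace (zigzag-step t)
  zigzag-step-closed xyz = proj₁ (other-apex-spec (face-rotate xyz))

  zigzag-step-injective : ∀ {t t′} → IsFace t → IsFace t′ → zigzag-step t ≡ zigzag-step t′ → t ≡ t′
  zigzag-step-injective {x , y , z} {x′ , y′ , z′} xyz x′y′z′ e with cong proj₁ e | cong (proj₁ ∘ proj₂) e
  ... | refl | refl with proj₂ (proj₂ (other-apex-spec (face-rotate xyz))) x′ (face-rotate x′y′z′)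
  ...   | inj₁ x′≡x    = cong (λ w → w , y , z) (sym x′≡x)
  ...   | inj₂ x′≡apex = contradiction (sym (trans x′≡apex (cong (proj₂ ∘ proj₂) e)))
                                       (proj₁ (proj₂ (other-apex-spec (face-rotate x′y′z′))))

  encode-flag : Flag → Fin (N * (N * N))
  encode-flag (x , y , z) = combine x (combine y z)

  encode-flag-injective : ∀ {t t′} → encode-flag t ≡ encode-flag t′ → t ≡ t′
  encode-flag-injective {x , y , z} {x′ , y′ , z′} e with combine-injective x _ x′ _ e
  ... | refl , e′ with combine-injective y z y′ z′ e′
  ...   | refl , refl = refl

  flag-disjoint : ∀ {x y z} → face x y z ≡ true →
                  x ≢ z × x ≢ other-apex x y z × y ≢ z × y ≢ other-apex x y z
  flag-disjoint {x} {y} {z} xyz =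
    face-distinct x z y (trans (sym (face-sym₂ x y z)) xyz) ,
    apex≢x ∘ sym ,
    face-distinct y z x (face-rotate xyz) ,
    face-distinct y _ z (trans (sym (face-sym₂ y z _)) yz-apex)
    where
    yz-apex = proj₁ (other-apex-spec (face-rotate xyz))
    apex≢x  = proj₁ (proj₂ (other-apex-spec (face-rotate xyz)))

  open InjectiveOrbits encode-flag encode-flag-injective zigzag-step-closed zigzag-step-injective

  zigzag-through : ∀ {x y z} → face x y z ≡ true → Σ (Zigzag T) λ Z → seq Z 0 ≡ x × seq Z 1 ≡ y
  zigzag-through {x} {y} {z} xyz = Z , refl , refl
    where
    orbit : ℕ → Flag
    orbit = fold (x , y , z) zigzag-step

    orbit-face : ∀ i → IsFace (orbit i)
    orbit-face = fold-closed xyz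

    vertices : ℕ → Fin N
    vertices = proj₁ ∘ orbit

    vertices-period : ∃ (IsPeriod vertices)
    vertices-period with orbit-periodic xyz
    ... | d , 0<d , returns = d , 0<d , cong proj₁ ∘ returns

    Z : Zigzag T
    Z with least-period _≟_ vertices (proj₂ vertices-period)
    ... | p , (0<p , p-period) , shorter = record
      { len               = p
      ; len-pos           = 0<p
      ; seq               = vertices
      ; periodic          = p-period
      ; minimal           = λ k 0<k k<p k-period → shorter k<p (0<k , k-period)
      ; zz-face           = orbit-face
      ; zz-distinct-faces = λ i → proj₁ (proj₂ (other-apex-spec (face-rotate (orbit-face i))))
      ; zz-disjoint       = λ i → flag-disjoint (orbit-face i)
      }

T-≟-pair : ∀ {n} {a b u v : Fin n} → Bool.T (⌊ a ≟ u ⌋ Bool.∧ ⌊ b ≟ v ⌋) ⇔ (a ≡ u × b ≡ v)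
T-≟-pair {a = a} {b} {u} {v} with a ≟ u | b ≟ v
... | yes a≡u | yes b≡v = mk⇔ (λ _ → a≡u , b≡v) _
... | yes _   | no  b≢v = mk⇔ (λ ()) (b≢v ∘ proj₂)
... | no  a≢u | _       = mk⇔ (λ ()) (a≢u ∘ proj₁)

module _ (T : Triangulation) (τ : List (Zigzag T)) where
  open Triangulation T

  Step : Fin N → Fin N → Set
  Step u v = trav T τ u v ≡ true

  step-intro : ∀ {Z} → Z ∈ τ → ∀ i → Step (seq Z i) (seq Z (suc i))
  step-intro {Z} Z∈τ i = subst₂ Step (periodic-% (periodic Z) i) (periodic-% (periodic Z ∘ suc) i)
    (to T-≡ (any⁺ _ (lose Z∈τ (any⁺ _ (lose (∈-upTo⁺ (m%n<n i (len Z)))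
      (from (T-≟-pair {a = seq Z j} {seq Z (suc j)}) (refl , refl)))))))
    where
    instance
      len-nonZero : NonZero (len Z)
      len-nonZero = >-nonZero (len-pos Z)
    j = i % len Z

  step-elim : ∀ {u v} → Step u v → ∃ λ Z → Z ∈ τ × ∃ λ i → seq Z i ≡ u × seq Z (suc i) ≡ v
  step-elim uv with find (any⁻ _ τ (from T-≡ uv))
  ... | Z , Z∈τ , Z-traverses with find (any⁻ _ (upTo (len Z)) Z-traverses)
  ...   | i , _ , i-traverses = Z , Z∈τ , i , to T-≟-pair i-traverses

  walk-along : ∀ {Z} → Z ∈ τ → ∀ k i → Walk Step k (seq Z i) (seq Z (k + i))
  walk-along     Z∈τ zero    i = []
  walk-along {Z} Z∈τ (suc k) i =
    step-intro Z∈τ i ∷ subst (Walk Step k (seq Z (suc i)) ∘ seq Z) (+-suc k i) (walk-along Z∈τ k (suc i))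

  step-reversible : ∀ {u v} → Step u v → ∃ λ k → Walk Step k v u
  step-reversible uv with step-elim uv
  ... | Z , Z∈τ , i , refl , refl =
    pred (len Z) , subst (Walk Step _ (seq Z (suc i))) around (walk-along Z∈τ (pred (len Z)) (suc i))
    where
    around : seq Z (pred (len Z) + suc i) ≡ seq Z i
    around = trans (cong (seq Z) (trans (+-suc _ i) (trans (cong (_+ i) (suc-pred (len Z) {{>-nonZero (len-pos Z)}}))
                                                          (+-comm (len Z) i))))
                   (periodic Z i)

  ∈τ⇒step : ∀ {X : Raw T} → _∈τ_ T X τ → ∀ i → Step (proj₂ X i) (proj₂ X (suc i))
  ∈τ⇒step X∈τ i with find X∈τ
  ... | Z , Z∈τ , _ , s , rotated =
    subst₂ Step (rotated i) (trans (cong (seq Z) (sym (+-suc s i))) (rotated (suc i))) (step-intro Z∈τ (s + i))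

  -- Index i of the reversal is n (i + 1) ∸ i, which is −i modulo n.
  rev-traverses-backwards : ∀ {n} {w : ℕ → Fin N} → (∀ i → w (i + n) ≡ w i) → 0 < n →
                            proj₂ (rev T (n , w)) (pred n) ≡ w 1 × proj₂ (rev T (n , w)) (suc (pred n)) ≡ w 0
  rev-traverses-backwards {suc m} {w} w-periodic _ =
    trans (cong w (trans (cong (_∸ m) (sym (+-suc m (m * suc m)))) (m+n∸m≡n m (suc (m * suc m)))))
          (periodic-+* w-periodic 1 m) ,
    trans (cong w (trans (cong (_∸ suc m) (*-suc (suc m) (suc m))) (m+n∸m≡n (suc m) (suc m * suc m))))
          (periodic-+* w-periodic 0 (suc m))

  module _ (τ-orientation : IsZOrientation T τ) where

    edge-traversed : ∀ {u v} → Edge u v → Step u v ⊎ Step v u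
    edge-traversed (_ , uvw) with zigzag-through T uvw
    ... | Z , refl , refl with proj₁ (τ-orientation Z)
    ...   | inj₁ Z∈τ   = inj₁ (∈τ⇒step Z∈τ 0)
    ...   | inj₂ Z⁻¹∈τ = inj₂ (subst₂ Step backwards₁ backwards₀ (∈τ⇒step Z⁻¹∈τ (pred (len Z))))
      where
      backwards₁ = proj₁ (rev-traverses-backwards (periodic Z) (len-pos Z))
      backwards₀ = proj₂ (rev-traverses-backwards (periodic Z) (len-pos Z))

    strongly-connected : ∀ u v → ∃ λ k → Walk Step k u v
    strongly-connected u v = along (connected u v)
      where
      along : ∀ {u v} → Star Edge u v → ∃ λ k → Walk Step k u v
      along ε = 0 , []
      along (uv ◅ rest) with along rest | edge-traversed uv
      ... | k , w | inj₁ u→v = suc k , u→v ∷ w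
      ... | k , w | inj₂ v→u with step-reversible v→u
      ...   | j , w′ = j + k , w′ ++ w

  ≤-sumFinℕ : ∀ {n} (f : Fin n → ℕ) j → f j ≤ sumFinℕ T f
  ≤-sumFinℕ f Fin.zero    = m≤m+n _ _
  ≤-sumFinℕ f (Fin.suc j) = ≤-trans (≤-sumFinℕ (f ∘ Fin.suc) j) (m≤n+m _ _)

  step⇒weight>0 : ∀ {u v} → Step u v → 0 < weight T τ u v
  step⇒weight>0 {u} {v} uv rewrite uv with trav T τ v u
  ... | true  = s≤s z≤n
  ... | false = s≤s z≤n

  transition≥0 : ∀ u v → 0ℚ ℚ.≤ transition T τ u v
  transition≥0 u v with deg T τ u
  ... | zero  = ℚ.≤-refl
  ... | suc k = ℚ.nonNegative⁻¹ _ {{ℚ.normalize-nonNeg (weight T τ u v) (suc k)}}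

  step⇒transition>0 : ∀ {u v} → Step u v → 0ℚ ℚ.< transition T τ u v
  step⇒transition>0 {u} {v} uv with deg T τ u | ≤-trans (step⇒weight>0 uv) (≤-sumFinℕ (weight T τ u) v)
  ... | zero  | ()
  ... | suc k | _ with weight T τ u v | step⇒weight>0 uv
  ...   | suc w | _ = ℚ.positive⁻¹ _ {{ℚ.normalize-pos (suc w) (suc k)}}

proposition3 : (T : Triangulation) (τ : List (Zigzag T)) →
    IsZOrientation T τ → HasFaceOfTypeI T τ → Ergodic (transition T τ)
proposition3 T τ τ-orientation (a , b , c , _ , (a→b , b→a) , (b→c , c→b) , ca-or-ac) =
  irreducible P P≥0 P>0 reach , aperiodic P P≥0 P>0 reach (a→b ∷ b→a ∷ []) (triangle ca-or-ac)
  where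
  P     = transition T τ
  P≥0   = transition≥0 T τ
  P>0   = step⇒transition>0 T τ
  reach = strongly-connected T τ τ-orientation

  triangle : TypeII T τ c a ⊎ TypeII T τ a c → Walk (Step T τ) 3 a a
  triangle (inj₁ (c→a , _)) = a→b ∷ b→c ∷ c→a ∷ []
  triangle (inj₂ (a→c , _)) = a→c ∷ c→b ∷ b→a ∷ []
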